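{- Let $H$ be a finite connected graph, let $C$ be an odd cycle, and let $f: C\to H$ be a homomorphism. If $f$ belongs to the connected component of $H^C$ containing the constant maps, then $\sigma_{\mathcal{G}^*(H)}(f)=1_{\mathcal{G}^*(H)}$.
   Context: For graphs $G,H$, the exponential graph $H^G$ has as vertices all functions $V(G)\to V(H)$, with $[f,g]$ an edge (possibly a loop, $f=g$) iff $[f(u),g(v)]\in E(H)$ for every edge $[u,v]\in E(G)$; thus $f$ is a loop iff $f$ is a homomorphism. Since $H$ is connected, all constant maps lie in one connected component of $H^C$. $A(H)$ is the set of arcs of $H$: each edge $[u,v]$ gives the two arcs $(u,v),(v,u)$. $\mathcal{F}^*(A(H))$ is the free group on $A(H)$, and $\mathcal{G}^*(H)$ is its quotient by the normal subgroup generated by the elements $(u,v)\cdot(w,v)^{ -1}\cdot(w,x)\cdot(u,x)^{ -1}$ for every 4-cycle $u,v,w,x$ of $H$ (edges $uv,vw,wx,xu$). Let $C$ have vertex set $\mathbb{Z}_{2n+1}$ with $i$ adjacent to $i+1$. For an arc $(f,g)$ of $H^C$ define $\sigma_{\mathcal{F}^*(A(H))}(f,g)=\prod_{i=0}^{2n}(f(2i),g(2i+1))\cdot(f(2i+2),g(2i+1))^{ -1}$, indices mod $2n+1$, product taken left to right ($x_0x_1\cdots x_{2n}$). For a non-isolated vertex $f$ of $H^C$, $\sigma_{\mathcal{G}^*(H)}(f)$ is the image in $\mathcal{G}^*(H)$ of $\sigma_{\mathcal{F}^*(A(H))}(f,g)$ for any neighbour $g$ of $f$ (this does not depend on the choice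 of $g$). -}

module Defs where

open import Data.Nat using (ℕ; zero; suc; _+_; _*_; _%_; NonZero)
open import Data.Nat.DivMod using (_mod_; %-distribˡ-+; m%n%n≡m%n)
open import Data.Fin using (Fin; toℕ; fromℕ<)
open import Data.Fin.Properties using (toℕ-fromℕ<)
open import Data.Bool using (Bool; true; false; not; T)
open import Data.List using (List; []; _∷_; _++_)
open import Data.Product using (∃; _,_)
open import Data.Sum using (_⊎_; inj₁; inj₂)
open import Relation.Binary.PropositionalEquality
  using (_≡_; refl; sym; trans; cong)
open import Relation.Binary.Construct.Closure.ReflexiveTransitive using (Star)

Adj : ℕ → Set
Adj m = Fin m → Fin m → Bool

Symmetric : ∀ {m} → Adj m → Set
Symmetric {m} E = ∀ (u v : Fin m) → T (E u v) → T (E v u)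

Connected : ∀ {m} → Adj m → Set
Connected {m} E = ∀ (u v : Fin m) → Star (λ a b → T (E a b)) u v

-- The odd cycle C = C_{2n+1} on Z_{2n+1} = Fin (suc (2 * n)).

Len : ℕ → ℕ
Len n = suc (2 * n)

idx : (n : ℕ) → ℕ → Fin (Len n)
idx n k = k mod (Len n)

CAdj : (n : ℕ) → Fin (Len n) → Fin (Len n) → Set
CAdj n a b = (toℕ b ≡ suc (toℕ a) % Len n) ⊎ (toℕ a ≡ suc (toℕ b) % Len n)

-- Exponential graph H^C: [f,g] is an edge iff [f u, g v] ∈ E(H)
-- for every edge [u,v] of C (both orientations).

ExpAdj : ∀ {m} (E : Adj m) (n : ℕ) →
         (Fin (Len n) → Fin m) → (Fin (Len n) → Fin m) → Set
ExpAdj E n f g = ∀ u v → CAdj n u v → T (E (f u) (g v))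

IsHom : ∀ {m} (E : Adj m) (n : ℕ) → (Fin (Len n) → Fin m) → Set
IsHom E n f = ExpAdj E n f f

InConstComponent : ∀ {m} (E : Adj m) (n : ℕ) → (Fin (Len n) → Fin m) → Set
InConstComponent {m} E n f = ∃ λ (c : Fin m) → Star (ExpAdj E n) f (λ _ → c)

-- Free group on the arcs A(H): words of signed arcs.
-- A letter is an arc (u,v) (with u v adjacent) and a sign
-- (true = the arc, false = its inverse).

data Letter {m} (E : Adj m) : Set where
  lt : (u v : Fin m) → T (E u v) → Bool → Letter E

inv : ∀ {m} {E : Adj m} → Letter E → Letter E
inv (lt u v e s) = lt u v e (not s)

Word : ∀ {m} → Adj m → Set
Word E = List (Letter E)

relator : ∀ {m} {E : Adj m} (u v w x : Fin m) →
          T (E u v) → T (E w v) → T (E w x) → T (E u x) → Word E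
relator u v w x e₁ e₂ e₃ e₄ =
  lt u v e₁ true ∷ lt w v e₂ false ∷ lt w x e₃ true ∷ lt u x e₄ false ∷ []

-- Equality in G*(H) = ⟨ A(H) | 4-cycle relators ⟩: the congruence on
-- words generated by free cancellation and deletion of relators.
data _≈G_ {m} {E : Adj m} : Word E → Word E → Set where
  ≈refl   : ∀ {w} → w ≈G w
  ≈sym    : ∀ {w w'} → w ≈G w' → w' ≈G w
  ≈trans  : ∀ {w w' w''} → w ≈G w' → w' ≈G w'' → w ≈G w''
  cancel  : ∀ (a b : Word E) (x : Letter E) →
            (a ++ x ∷ inv x ∷ b) ≈G (a ++ b)
  cancel' : ∀ (a b : Word E) (x : Letter E) →
            (a ++ inv x ∷ x ∷ b) ≈G (a ++ b)
  rel     : ∀ (a b : Word E) (u v w x : Fin m)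
              (e₁ : T (E u v)) (e₂ : T (E w v)) (e₃ : T (E w x)) (e₄ : T (E u x)) →
            (a ++ relator u v w x e₁ e₂ e₃ e₄ ++ b) ≈G (a ++ b)

private
  suc-mod : ∀ k d .{{_ : NonZero d}} → suc k % d ≡ suc (k % d) % d
  suc-mod k d = trans (%-distribˡ-+ 1 k d)
                 (trans (cong (λ z → (1 % d + z) % d) (sym (m%n%n≡m%n k d)))
                        (sym (%-distribˡ-+ 1 (k % d) d)))

toℕ-idx : ∀ n k → toℕ (idx n k) ≡ k % Len n
toℕ-idx n k = toℕ-fromℕ< _

idx-adj : ∀ n k → CAdj n (idx n k) (idx n (suc k))
idx-adj n k = inj₁ (trans (toℕ-idx n (suc k))
                (trans (suc-mod k (Len n)) (cong (λ z → suc z % Len n) (sym (toℕ-idx n k)))))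

idx-adj' : ∀ n k → CAdj n (idx n (suc k)) (idx n k)
idx-adj' n k with idx-adj n k
... | inj₁ p = inj₂ p
... | inj₂ p = inj₁ p

-- σ_{F*(A(H))}(f,g) = ∏_{i=0}^{2n} (f(2i), g(2i+1)) · (f(2i+2), g(2i+1))⁻¹
-- (indices mod 2n+1, left-to-right product).

σ-factor : ∀ {m} (E : Adj m) (n : ℕ) (f g : Fin (Len n) → Fin m) →
           ExpAdj E n f g → ℕ → Word E
σ-factor E n f g adj i =
  lt (f (idx n (2 * i))) (g (idx n (suc (2 * i))))
     (adj _ _ (idx-adj n (2 * i))) true
  ∷ lt (f (idx n (suc (suc (2 * i))))) (g (idx n (suc (2 * i))))
     (adj _ _ (idx-adj' n (suc (2 * i)))) false
  ∷ []

σ-from : ∀ {m} (E : Adj m) (n : ℕ) (f g : Fin (Len n) → Fin m) →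
         ExpAdj E n f g → ℕ → ℕ → Word E
σ-from E n f g adj j zero    = []
σ-from E n f g adj j (suc k) = σ-factor E n f g adj j ++ σ-from E n f g adj (suc j) k

σF : ∀ {m} (E : Adj m) (n : ℕ) (f g : Fin (Len n) → Fin m) →
     ExpAdj E n f g → Word E
σF E n f g adj = σ-from E n f g adj 0 (Len n)

-- Modulo the 4-cycle relators, σ(f,g) does not depend on the neighbour g:
-- changing g(2i+1) alters the i-th factor (f(2i),g(2i+1))(f(2i+2),g(2i+1))⁻¹
-- along a 4-cycle of H. Dually, if f and h share a neighbour g, then regrouping
-- σ(f,g) into the factors (f(2i+2),g(2i+1))⁻¹(f(2i+2),g(2i+3)), which agree
-- with those of h along 4-cycles, shows that σ(h,g) is a conjugate of σ(f,g).
-- So triviality of σ passes from z to x whenever x ~ y ~ z in H^C; it holds for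
-- constant maps, whose factors cancel freely, and a walk to a constant map
-- carries it to f.
module Submission where

open import Defs
open import Data.Nat using (ℕ; zero; suc; _+_; _*_; _≤_)
open import Data.Nat.Properties using (+-suc; +-identityʳ; *-suc)
open import Data.Nat.DivMod using ([m+kn]%n≡m%n)
open import Data.Fin using (Fin)
open import Data.Fin.Properties using (toℕ-injective)
open import Data.Bool using (true; false; T)
open import Data.Bool.Properties using (T-irrelevant)
open import Data.List using ([]; _∷_; _++_; [_])
open import Data.List.Properties using (++-assoc; ++-identityʳ)
open import Data.Product using (_×_; _,_; proj₁)
open import Data.Sum using (inj₁; inj₂)
open import Function using (_⇔_; mk⇔; Equivalence)
open import Relation.Binary.Bundles using (Setoid)
open import Relation.Binary.PropositionalEquality
  using (_≡_; refl; sym; trans; cong; subst₂)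
open import Relation.Binary.Construct.Closure.ReflexiveTransitive using (Star; ε; _◅_)
import Relation.Binary.Reasoning.Setoid as SetoidReasoning

module _ {m : ℕ} {E : Adj m} where

  ≈G-setoid : Setoid _ _
  ≈G-setoid = record
    { Carrier       = Word E
    ; _≈_           = _≈G_
    ; isEquivalence = record { refl = ≈refl ; sym = ≈sym ; trans = ≈trans }
    }

  open SetoidReasoning ≈G-setoid

  ≡⇒≈G : {w w' : Word E} → w ≡ w' → w ≈G w'
  ≡⇒≈G refl = ≈refl

  private
    ++-reassoc : ∀ (a a₀ c b : Word E) → a ++ (a₀ ++ c) ++ b ≡ (a ++ a₀) ++ (c ++ b)
    ++-reassoc a a₀ c b = trans (cong (a ++_) (++-assoc a₀ c b)) (sym (++-assoc a a₀ (c ++ b)))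

  ≈G-inContext : ∀ (a b : Word E) {w w'} → w ≈G w' → (a ++ w ++ b) ≈G (a ++ w' ++ b)
  ≈G-inContext a b ≈refl        = ≈refl
  ≈G-inContext a b (≈sym p)     = ≈sym (≈G-inContext a b p)
  ≈G-inContext a b (≈trans p q) = ≈trans (≈G-inContext a b p) (≈G-inContext a b q)
  ≈G-inContext a b (cancel a₀ b₀ x) =
    subst₂ _≈G_ (sym (++-reassoc a a₀ (x ∷ inv x ∷ b₀) b)) (sym (++-reassoc a a₀ b₀ b))
      (cancel (a ++ a₀) (b₀ ++ b) x)
  ≈G-inContext a b (cancel' a₀ b₀ x) =
    subst₂ _≈G_ (sym (++-reassoc a a₀ (inv x ∷ x ∷ b₀) b)) (sym (++-reassoc a a₀ b₀ b))
      (cancel' (a ++ a₀) (b₀ ++ b) x)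
  ≈G-inContext a b (rel a₀ b₀ u v w x e₁ e₂ e₃ e₄) =
    subst₂ _≈G_ (sym (++-reassoc a a₀ (relator u v w x e₁ e₂ e₃ e₄ ++ b₀) b))
      (sym (++-reassoc a a₀ b₀ b))
      (rel (a ++ a₀) (b₀ ++ b) u v w x e₁ e₂ e₃ e₄)

  ++-cong : ∀ {w w' v v' : Word E} → w ≈G w' → v ≈G v' → (w ++ v) ≈G (w' ++ v')
  ++-cong {w} {w'} {v} {v'} p q = begin
    w ++ v         ≈⟨ ≈G-inContext [] v p ⟩
    w' ++ v        ≡⟨ cong (w' ++_) (++-identityʳ v) ⟨
    w' ++ v ++ []  ≈⟨ ≈G-inContext w' [] q ⟩
    w' ++ v' ++ [] ≡⟨ cong (w' ++_) (++-identityʳ v') ⟩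
    w' ++ v'       ∎

  ∷-cancelˡ : ∀ x {w w' : Word E} → (x ∷ w) ≈G (x ∷ w') → w ≈G w'
  ∷-cancelˡ x {w} {w'} p = begin
    w                ≈⟨ cancel' [] w x ⟨
    inv x ∷ x ∷ w    ≈⟨ ++-cong (≈refl {w = [ inv x ]}) p ⟩
    inv x ∷ x ∷ w'   ≈⟨ cancel' [] w' x ⟩
    w'               ∎

  ∷ʳ-cancel : ∀ x {w w' : Word E} → (w ++ [ x ]) ≈G (w' ++ [ x ]) → w ≈G w'
  ∷ʳ-cancel x {w} {w'} p = begin
    w                          ≡⟨ ++-identityʳ w ⟨
    w ++ []                    ≈⟨ cancel w [] x ⟨
    w ++ x ∷ inv x ∷ []        ≡⟨ ++-assoc w [ x ] [ inv x ] ⟨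
    (w ++ [ x ]) ++ [ inv x ]  ≈⟨ ++-cong p ≈refl ⟩
    (w' ++ [ x ]) ++ [ inv x ] ≡⟨ ++-assoc w' [ x ] [ inv x ] ⟩
    w' ++ x ∷ inv x ∷ []       ≈⟨ cancel w' [] x ⟩
    w' ++ []                   ≡⟨ ++-identityʳ w' ⟩
    w'                         ∎

  lt-cong : ∀ {u u' v v' p q s} → u ≡ u' → v ≡ v' → lt {E = E} u v p s ≡ lt u' v' q s
  lt-cong refl refl = cong (λ e → lt _ _ e _) (T-irrelevant _ _)

  module _ (x y z t : Letter E) (xyzt≈[] : (x ∷ y ∷ z ∷ t ∷ []) ≈G []) where

    front≈inverse-back : (x ∷ y ∷ []) ≈G (inv t ∷ inv z ∷ [])
    front≈inverse-back = begin
      x ∷ y ∷ []                             ≈⟨ cancel (x ∷ y ∷ []) [] z ⟨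
      x ∷ y ∷ z ∷ inv z ∷ []                 ≈⟨ cancel (x ∷ y ∷ z ∷ []) [ inv z ] t ⟨
      x ∷ y ∷ z ∷ t ∷ inv t ∷ inv z ∷ []     ≈⟨ ≈G-inContext [] (inv t ∷ inv z ∷ []) xyzt≈[] ⟩
      inv t ∷ inv z ∷ []                     ∎

    middle≈inverse-ends : (y ∷ z ∷ []) ≈G (inv x ∷ inv t ∷ [])
    middle≈inverse-ends = begin
      y ∷ z ∷ []                             ≈⟨ cancel' [] (y ∷ z ∷ []) x ⟨
      inv x ∷ x ∷ y ∷ z ∷ []                 ≈⟨ cancel (inv x ∷ x ∷ y ∷ z ∷ []) [] t ⟨
      inv x ∷ x ∷ y ∷ z ∷ t ∷ inv t ∷ []     ≈⟨ ≈G-inContext [ inv x ] [ inv t ] xyzt≈[] ⟩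
      inv x ∷ inv t ∷ []                     ∎

  module _ {u v w x : Fin m} {e₁ : T (E u v)} {e₂ : T (E w v)} {e₃ : T (E w x)} {e₄ : T (E u x)}
    where

    relator≈[] : relator u v w x e₁ e₂ e₃ e₄ ≈G []
    relator≈[] = rel [] [] u v w x e₁ e₂ e₃ e₄

    square-swapʳ : (lt u v e₁ true ∷ lt w v e₂ false ∷ []) ≈G (lt u x e₄ true ∷ lt w x e₃ false ∷ [])
    square-swapʳ = front≈inverse-back _ _ _ _ relator≈[]

    square-swapˡ : (lt w v e₂ false ∷ lt w x e₃ true ∷ []) ≈G (lt u v e₁ false ∷ lt u x e₄ true ∷ [])
    square-swapˡ = middle≈inverse-ends _ _ _ _ relator≈[]

  ∏ : (ℕ → Word E) → ℕ → ℕ → Word E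
  ∏ F j zero    = []
  ∏ F j (suc k) = F j ++ ∏ F (suc j) k

  ∏-cong : ∀ {F F'} → (∀ i → F i ≈G F' i) → ∀ j k → ∏ F j k ≈G ∏ F' j k
  ∏-cong F≈F' j zero    = ≈refl
  ∏-cong F≈F' j (suc k) = ++-cong (F≈F' j) (∏-cong F≈F' (suc j) k)

  ∏-trivial : ∀ {F} → (∀ i → F i ≈G []) → ∀ j k → ∏ F j k ≈G []
  ∏-trivial F≈[] j zero    = ≈refl
  ∏-trivial F≈[] j (suc k) = ++-cong (F≈[] j) (∏-trivial F≈[] (suc j) k)

  alternating : (A B : ℕ → Letter E) → ℕ → ℕ → Word E
  alternating A B = ∏ (λ i → A i ∷ B i ∷ [])

  shifted : (A B : ℕ → Letter E) → ℕ → ℕ → Word E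
  shifted A B = ∏ (λ i → B i ∷ A (suc i) ∷ [])

  alternating-∷ʳ : ∀ A B j k → alternating A B j k ++ [ A (j + k) ] ≡ A j ∷ shifted A B j k
  alternating-∷ʳ A B j zero    = cong (λ i → [ A i ]) (+-identityʳ j)
  alternating-∷ʳ A B j (suc k) rewrite +-suc j k =
    cong (λ r → A j ∷ B j ∷ r) (alternating-∷ʳ A B (suc j) k)

  alternating≈[]⇔shifted≈[] : ∀ A B K → A K ≡ A 0 →
                              alternating A B 0 K ≈G [] ⇔ shifted A B 0 K ≈G []
  alternating≈[]⇔shifted≈[] A B K AK≡A0 = mk⇔
    (λ alt≈[] → ∷-cancelˡ (A 0) (begin
      A 0 ∷ shifted A B 0 K           ≡⟨ alternating-∷ʳ A B 0 K ⟨
      alternating A B 0 K ++ [ A K ]  ≈⟨ ++-cong alt≈[] ≈refl ⟩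
      [ A K ]                         ≡⟨ cong [_] AK≡A0 ⟩
      [ A 0 ]                         ∎))
    (λ shifted≈[] → ∷ʳ-cancel (A K) (begin
      alternating A B 0 K ++ [ A K ]  ≡⟨ alternating-∷ʳ A B 0 K ⟩
      A 0 ∷ shifted A B 0 K           ≈⟨ ++-cong (≈refl {w = [ A 0 ]}) shifted≈[] ⟩
      [ A 0 ]                         ≡⟨ cong [_] AK≡A0 ⟨
      [ A K ]                         ∎))

  alternating≈[]-transfer : ∀ A B A' B' K → A K ≡ A 0 → A' K ≡ A' 0 →
    (∀ i → (B i ∷ A (suc i) ∷ []) ≈G (B' i ∷ A' (suc i) ∷ [])) →
    alternating A B 0 K ≈G [] → alternating A' B' 0 K ≈G []
  alternating≈[]-transfer A B A' B' K AK≡A0 A'K≡A'0 shifted-factors≈ alt≈[] =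
    Equivalence.from (alternating≈[]⇔shifted≈[] A' B' K A'K≡A'0)
      (≈trans (≈sym (∏-cong shifted-factors≈ 0 K))
              (Equivalence.to (alternating≈[]⇔shifted≈[] A B K AK≡A0) alt≈[]))

idx-periodic : ∀ n k j → idx n (k + j * Len n) ≡ idx n k
idx-periodic n k j =
  toℕ-injective (trans (toℕ-idx n (k + j * Len n))
                       (trans ([m+kn]%n≡m%n k j (Len n)) (sym (toℕ-idx n k))))

module _ {m : ℕ} {E : Adj m} (n : ℕ) where

  open SetoidReasoning (≈G-setoid {E = E})

  Map : Set
  Map = Fin (Len n) → Fin m

  forward : (f g : Map) → ExpAdj E n f g → ℕ → Letter E
  forward f g adj k = lt (f (idx n k)) (g (idx n (suc k))) (adj _ _ (idx-adj n k)) true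

  backward : (f g : Map) → ExpAdj E n f g → ℕ → Letter E
  backward f g adj k = lt (f (idx n (suc k))) (g (idx n k)) (adj _ _ (idx-adj' n k)) false

  σ-head σ-tail : (f g : Map) → ExpAdj E n f g → ℕ → Letter E
  σ-head f g adj i = forward f g adj (2 * i)
  σ-tail f g adj i = backward f g adj (suc (2 * i))

  σ-from≡alternating : ∀ f g adj j k →
    σ-from E n f g adj j k ≡ alternating (σ-head f g adj) (σ-tail f g adj) j k
  σ-from≡alternating f g adj j zero    = refl
  σ-from≡alternating f g adj j (suc k) =
    cong (λ r → σ-head f g adj j ∷ σ-tail f g adj j ∷ r) (σ-from≡alternating f g adj (suc j) k)

  σF≡alternating : ∀ f g adj → σF E n f g adj ≡ alternating (σ-head f g adj) (σ-tail f g adj) 0 (Len n)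
  σF≡alternating f g adj = σ-from≡alternating f g adj 0 (Len n)

  forward-periodic : ∀ f g adj k j → forward f g adj (k + j * Len n) ≡ forward f g adj k
  forward-periodic f g adj k j = lt-cong (cong f (idx-periodic n k j)) (cong g (idx-periodic n (suc k) j))

  σF-independent : ∀ f g g' (adj : ExpAdj E n f g) (adj' : ExpAdj E n f g') →
                   σF E n f g adj ≈G σF E n f g' adj'
  σF-independent f g g' adj adj' = begin
    σF E n f g adj
      ≡⟨ σF≡alternating f g adj ⟩
    alternating (σ-head f g adj) (σ-tail f g adj) 0 (Len n)
      ≈⟨ ∏-cong (λ _ → square-swapʳ) 0 (Len n) ⟩
    alternating (σ-head f g' adj') (σ-tail f g' adj') 0 (Len n)
      ≡⟨ σF≡alternating f g' adj' ⟨
    σF E n f g' adj' ∎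

  σF≈[]-commonNeighbour : ∀ f h g (adjF : ExpAdj E n f g) (adjH : ExpAdj E n h g) →
                          σF E n f g adjF ≈G [] → σF E n h g adjH ≈G []
  σF≈[]-commonNeighbour f h g adjF adjH σF≈[] = begin
    σF E n h g adjH ≡⟨ σF≡alternating h g adjH ⟩
    alternating (σ-head h g adjH) (σ-tail h g adjH) 0 (Len n)
      ≈⟨ alternating≈[]-transfer _ _ _ _ (Len n)
           (forward-periodic f g adjF 0 2) (forward-periodic h g adjH 0 2) shifted-factors≈
           (≈trans (≡⇒≈G (sym (σF≡alternating f g adjF))) σF≈[]) ⟩
    [] ∎
    where
      shifted-factors≈ : ∀ i → (σ-tail f g adjF i ∷ σ-head f g adjF (suc i) ∷ [])
                            ≈G (σ-tail h g adjH i ∷ σ-head h g adjH (suc i) ∷ [])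
      shifted-factors≈ i = begin
        σ-tail f g adjF i ∷ forward f g adjF (2 * suc i) ∷ []
          ≡⟨ cong (λ k → σ-tail f g adjF i ∷ forward f g adjF k ∷ []) (*-suc 2 i) ⟩
        σ-tail f g adjF i ∷ forward f g adjF (2 + 2 * i) ∷ []
          ≈⟨ square-swapˡ ⟩
        σ-tail h g adjH i ∷ forward h g adjH (2 + 2 * i) ∷ []
          ≡⟨ cong (λ k → σ-tail h g adjH i ∷ forward h g adjH k ∷ []) (*-suc 2 i) ⟨
        σ-tail h g adjH i ∷ forward h g adjH (2 * suc i) ∷ [] ∎

  σ-Trivial : Map → Set
  σ-Trivial f = ∀ g (adj : ExpAdj E n f g) → σF E n f g adj ≈G []

  const-σ-Trivial : ∀ c → σ-Trivial (λ _ → c)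
  const-σ-Trivial c g adj = begin
    σF E n (λ _ → c) g adj ≡⟨ σF≡alternating (λ _ → c) g adj ⟩
    alternating (σ-head _ g adj) (σ-tail _ g adj) 0 (Len n) ≈⟨ ∏-trivial factor≈[] 0 (Len n) ⟩
    [] ∎
    where
      factor≈[] : ∀ i → (σ-head _ g adj i ∷ σ-tail _ g adj i ∷ []) ≈G []
      factor≈[] i = ≈trans (≡⇒≈G (cong (λ b → σ-head _ g adj i ∷ b ∷ []) (lt-cong refl refl)))
                           (cancel [] [] (σ-head _ g adj i))

  module _ (symE : Symmetric E) where

    ExpAdj-sym : ∀ {f g} → ExpAdj E n f g → ExpAdj E n g f
    ExpAdj-sym adj u v (inj₁ uv) = symE _ _ (adj v u (inj₂ uv))
    ExpAdj-sym adj u v (inj₂ vu) = symE _ _ (adj v u (inj₁ vu))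

    σ-Trivial-twoSteps : ∀ {x y z} → ExpAdj E n x y → ExpAdj E n y z → σ-Trivial z → σ-Trivial x
    σ-Trivial-twoSteps {x} {y} {z} xy yz trivial-z g adj =
      ≈trans (σF-independent x g y adj xy)
             (σF≈[]-commonNeighbour z x y (ExpAdj-sym yz) xy (trivial-z y (ExpAdj-sym yz)))

    σ-Trivial-walkToConst : ∀ c {f} → Star (ExpAdj E n) f (λ _ → c) →
                            σ-Trivial f × (∀ h → ExpAdj E n h f → σ-Trivial h)
    σ-Trivial-walkToConst c ε = const-σ-Trivial c , neighbour-trivial
      where
        neighbour-trivial : ∀ h → ExpAdj E n h (λ _ → c) → σ-Trivial h
        -- h ~ const c ~ const (h 0), the second edge coming from the edge h(0) c of H.
        neighbour-trivial h hc =
          σ-Trivial-twoSteps hc (λ _ _ _ → symE _ _ (hc _ _ (idx-adj n 0)))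
                             (const-σ-Trivial (h (idx n 0)))
    σ-Trivial-walkToConst c (fy ◅ walk) with σ-Trivial-walkToConst c walk
    ... | trivial-y , neighbours-trivial = neighbours-trivial _ fy ,
                                           λ h hf → σ-Trivial-twoSteps hf fy trivial-y

proposition5 : (m : ℕ) (E : Adj m) → Symmetric E → Connected E →
    (n : ℕ) → 1 ≤ n →
    (f : Fin (Len n) → Fin m) → IsHom E n f → InConstComponent E n f →
    (g : Fin (Len n) → Fin m) (adj : ExpAdj E n f g) →
    σF E n f g adj ≈G []
proposition5 m E symE _ n _ f _ (c , walk) = proj₁ (σ-Trivial-walkToConst n symE c walk)
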